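{- Let $\Gamma=(V,E)$ be a reduced graph, let $\tau_0\in\mathrm{Sym}(V)$, let $E'=\{(v,w)\in V\times V\mid (v,\tau_0^{ -1}(w))\in E\}$ and $\Gamma'=(V,E')$. Then there is a bijection $\varphi:V\to V$ with $(v,w)\in E\iff(\varphi(v),\varphi(w))\in E'$ for all $v,w$ (i.e. $\Gamma\cong\Gamma'$) if and only if $\tau_0\in\mathrm{im}(\alpha_\Gamma)$.
   Context: A graph is $\Gamma=(V,E)$ with $V$ finite and $E\subseteq V\times V$ symmetric and irreflexive; $N(v)=\{w\mid(v,w)\in E\}$; $\Gamma$ is reduced if $N(v)\ne N(w)$ whenever $v\ne w$. A two-fold automorphism of $\Gamma$ is a pair $(\sigma_1,\sigma_2)\in\mathrm{Sym}(V)^2$ such that $(v,w)\in E\iff(\sigma_1(v),\sigma_2(w))\in E$ for all $v,w\in V$. $\mathrm{Aut}^\pi(\Gamma)$ is the group of all $\sigma_1$ for which some $\sigma_2$ makes $(\sigma_1,\sigma_2)$ a two-fold automorphism; when $\Gamma$ is reduced this $\sigma_2$ is unique, and one writes $\gamma(\sigma_1)=\sigma_2$. The map $\alpha_\Gamma:\mathrm{Aut}^\pi(\Gamma)\to\mathrm{Aut}^\pi(\Gamma)$ is $\alpha_\Gamma(\tau)=\tau^{ -1}\circ\gamma(\tau)$ (composition right to left). -}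

module Defs where

open import Data.Nat using (ℕ)
open import Data.Fin using (Fin)
open import Data.Bool using (Bool; true)
open import Data.Product using (Σ; _×_)
open import Data.Fin.Permutation using (Permutation′; _⟨$⟩ʳ_; _⟨$⟩ˡ_)
open import Relation.Binary.PropositionalEquality using (_≡_; _≢_)
open import Relation.Nullary using (¬_)
open import Function.Bundles using (_⇔_)

record Graph (n : ℕ) : Set where
  field
    adj    : Fin n → Fin n → Bool
    symm   : ∀ v w → adj v w ≡ true → adj w v ≡ true
    irrefl : ∀ v → ¬ (adj v v ≡ true)
open Graph public

_∋E_,_ : ∀ {n} → Graph n → Fin n → Fin n → Set
Γ ∋E v , w = adj Γ v w ≡ true

SameNbhd : ∀ {n} → Graph n → Fin n → Fin n → Set
SameNbhd {n} Γ v w = ∀ (u : Fin n) → (Γ ∋E v , u) ⇔ (Γ ∋E w , u)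

Reduced : ∀ {n} → Graph n → Set
Reduced {n} Γ = ∀ (v w : Fin n) → v ≢ w → ¬ SameNbhd Γ v w

IsTwoFold : ∀ {n} → Graph n → Permutation′ n → Permutation′ n → Set
IsTwoFold {n} Γ σ₁ σ₂ =
  ∀ (v w : Fin n) → (Γ ∋E v , w) ⇔ (Γ ∋E (σ₁ ⟨$⟩ʳ v) , (σ₂ ⟨$⟩ʳ w))

InAutπ : ∀ {n} → Graph n → Permutation′ n → Set
InAutπ Γ τ = Σ _ λ σ₂ → IsTwoFold Γ τ σ₂

-- τ₀ ∈ im(α_Γ): there is τ ∈ Aut^π(Γ), with its (for reduced Γ unique)
-- partner γ(τ) = σ₂, such that τ⁻¹ ∘ γ(τ) = τ₀ (pointwise equality of permutations)
InImAlpha : ∀ {n} → Graph n → Permutation′ n → Set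
InImAlpha {n} Γ τ₀ =
  Σ (Permutation′ n) λ τ → Σ (Permutation′ n) λ σ₂ →
    IsTwoFold Γ τ σ₂ × (∀ (x : Fin n) → τ ⟨$⟩ˡ (σ₂ ⟨$⟩ʳ x) ≡ τ₀ ⟨$⟩ʳ x)

-- E' = {(v , w) | (v , τ₀⁻¹ w) ∈ E}   (a relation on V, not necessarily symmetric)
E′ : ∀ {n} → Graph n → Permutation′ n → Fin n → Fin n → Set
E′ Γ τ₀ v w = Γ ∋E v , (τ₀ ⟨$⟩ˡ w)

IsoToTwisted : ∀ {n} → Graph n → Permutation′ n → Set
IsoToTwisted {n} Γ τ₀ =
  Σ (Permutation′ n) λ φ →
    ∀ (v w : Fin n) → (Γ ∋E v , w) ⇔ E′ Γ τ₀ (φ ⟨$⟩ʳ v) (φ ⟨$⟩ʳ w)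

{-# OPTIONS --safe #-}
module Submission where

-- Unfolding E′, a bijection φ : Γ ≅ Γ′ is exactly a two-fold automorphism
-- (φ , τ₀⁻¹ ∘ φ). Two-fold automorphisms are closed under inversion, so
-- τ = φ⁻¹ lies in Aut^π(Γ) with γ(τ) = φ⁻¹ ∘ τ₀, i.e. α(τ) = τ₀. Conversely,
-- τ⁻¹ ∘ γ(τ) = τ₀ gives γ(τ)⁻¹ = τ₀⁻¹ ∘ τ⁻¹, so inverting (τ , γ(τ)) shows that
-- φ = τ⁻¹ is an isomorphism Γ ≅ Γ′. Reducedness only serves to make γ a
-- function.

open import Defs
open import Data.Nat using (ℕ)
open import Data.Product using (_,_)
open import Data.Fin.Permutation
  using (Permutation′; _⟨$⟩ʳ_; _⟨$⟩ˡ_; _≈_; flip; _∘ₚ_; inverseˡ; inverseʳ)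
open import Function.Bundles using (_⇔_; mk⇔)
import Function.Properties.Equivalence as ⇔
open import Relation.Binary.PropositionalEquality
  using (cong; subst; subst₂; module ≡-Reasoning)

σ∘ₚflipτ≈ρ⇒flipσ≈flipτ∘ₚflipρ : ∀ {n} (σ τ ρ : Permutation′ n) →
                                σ ∘ₚ flip τ ≈ ρ → flip σ ≈ flip τ ∘ₚ flip ρ
σ∘ₚflipτ≈ρ⇒flipσ≈flipτ∘ₚflipρ σ τ ρ σ∘ₚflipτ≈ρ y = begin
  σ ⟨$⟩ˡ y                             ≡⟨ inverseˡ ρ ⟨
  ρ ⟨$⟩ˡ (ρ ⟨$⟩ʳ (σ ⟨$⟩ˡ y))           ≡⟨ cong (ρ ⟨$⟩ˡ_) (σ∘ₚflipτ≈ρ (σ ⟨$⟩ˡ y)) ⟨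
  ρ ⟨$⟩ˡ (τ ⟨$⟩ˡ (σ ⟨$⟩ʳ (σ ⟨$⟩ˡ y)))  ≡⟨ cong (λ z → ρ ⟨$⟩ˡ (τ ⟨$⟩ˡ z)) (inverseʳ σ) ⟩
  ρ ⟨$⟩ˡ (τ ⟨$⟩ˡ y)                    ∎
  where open ≡-Reasoning

module _ {n : ℕ} (Γ : Graph n) where

  isTwoFold-flip : ∀ {σ₁ σ₂} → IsTwoFold Γ σ₁ σ₂ → IsTwoFold Γ (flip σ₁) (flip σ₂)
  isTwoFold-flip {σ₁} {σ₂} twoFold v w = ⇔.sym (subst₂
    (λ v′ w′ → (Γ ∋E (σ₁ ⟨$⟩ˡ v) , (σ₂ ⟨$⟩ˡ w)) ⇔ (Γ ∋E v′ , w′))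
    (inverseʳ σ₁) (inverseʳ σ₂) (twoFold (σ₁ ⟨$⟩ˡ v) (σ₂ ⟨$⟩ˡ w)))

  isTwoFold-respʳ-≈ : ∀ {σ₁ σ₂ σ₂′} → σ₂ ≈ σ₂′ → IsTwoFold Γ σ₁ σ₂ → IsTwoFold Γ σ₁ σ₂′
  isTwoFold-respʳ-≈ {σ₁} σ₂≈σ₂′ twoFold v w =
    subst (λ w′ → (Γ ∋E v , w) ⇔ (Γ ∋E (σ₁ ⟨$⟩ʳ v) , w′)) (σ₂≈σ₂′ w) (twoFold v w)

lemma2p7 : ∀ (n : ℕ) (Γ : Graph n) → Reduced Γ → (τ₀ : Permutation′ n) →
           IsoToTwisted Γ τ₀ ⇔ InImAlpha Γ τ₀
lemma2p7 n Γ _ τ₀ = mk⇔ iso⇒inImAlpha inImAlpha⇒iso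
  where
  -- The isomorphism condition of IsoToTwisted on φ is definitionally
  -- IsTwoFold Γ φ (φ ∘ₚ flip τ₀).
  iso⇒inImAlpha : IsoToTwisted Γ τ₀ → InImAlpha Γ τ₀
  iso⇒inImAlpha (φ , iso) =
    flip φ , flip (φ ∘ₚ flip τ₀) , isTwoFold-flip Γ {φ} {φ ∘ₚ flip τ₀} iso , λ _ → inverseʳ φ

  inImAlpha⇒iso : InImAlpha Γ τ₀ → IsoToTwisted Γ τ₀
  inImAlpha⇒iso (τ , σ₂ , twoFold , α[τ]≈τ₀) =
    flip τ , isTwoFold-respʳ-≈ Γ {flip τ} {flip σ₂} {flip τ ∘ₚ flip τ₀}
               (σ∘ₚflipτ≈ρ⇒flipσ≈flipτ∘ₚflipρ σ₂ τ τ₀ α[τ]≈τ₀)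
               (isTwoFold-flip Γ {τ} {σ₂} twoFold)
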